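{- Let $\mathbf{u}$ be either $\mathbf{r}$ or $\mathbf{s}$. For every finite binary word $w$, $w$ is a subword of $\mathbf{u}$ if and only if $\overline{w}$ is a subword of $\mathbf{u}$.
   Context: $\mathbf{r}=(r_n)_{n\geq0}$ with $r_n=e_{11}(n)\bmod 2$, where $e_{11}(n)$ is the number of (possibly overlapping) occurrences of $11$ in the binary expansion of $n$; $\mathbf{s}=(s_n)_{n\geq0}$ with $s_n=r_{2n+1}$. A subword of an infinite word is a finite block of consecutive letters. $\overline{w}$ denotes the binary negation of $w$ (swapping $0$ and $1$). -}

module Defs where

open import Data.Nat using (ℕ; zero; suc; _+_; _*_)
open import Data.Nat.DivMod using (_/_; _%_)
open import Data.Bool using (Bool; true; false; not; _xor_)
open import Data.List using (List; []; _∷_; map)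
open import Data.Product using (∃-syntax; _×_)
open import Data.Unit using (⊤)
open import Relation.Binary.PropositionalEquality using (_≡_)

-- Infinite binary words are functions ℕ → Bool (false = 0, true = 1).
InfWord : Set
InfWord = ℕ → Bool

isOne : ℕ → Bool
isOne zero = false
isOne (suc _) = true

-- Binary digits of n, least significant first, with no leading zeros
-- (0 has the empty expansion).  The fuel argument (≥ number of digits)
-- only ensures structural termination; we use fuel = n.
bitsF : ℕ → ℕ → List Bool
bitsF zero    _ = []
bitsF (suc f) zero = []
bitsF (suc f) (suc m) = isOne (suc m % 2) ∷ bitsF f (suc m / 2)

bits : ℕ → List Bool
bits n = bitsF n n

-- number of (possibly overlapping) occurrences of the factor 11
-- in a digit list (reading order is irrelevant for the factor 11).
count11 : List Bool → ℕ
count11 [] = 0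
count11 (_ ∷ []) = 0
count11 (true ∷ true ∷ xs) = suc (count11 (true ∷ xs))
count11 (_ ∷ y ∷ xs) = count11 (y ∷ xs)

e11 : ℕ → ℕ
e11 n = count11 (bits n)

parity : ℕ → Bool
parity zero = false
parity (suc k) = not (parity k)

r : InfWord
r n = parity (e11 n)

s : InfWord
s n = r (suc (2 * n))

OccursAt : InfWord → ℕ → List Bool → Set
OccursAt u i [] = ⊤
OccursAt u i (b ∷ w) = (u i ≡ b) × OccursAt u (suc i) w

IsSubword : List Bool → InfWord → Set
IsSubword w u = ∃[ i ] OccursAt u i w

negate : List Bool → List Bool
negate = map not

-- The number 3·2^M·2 is written 11 followed by M + 1 zeros, so for x < 2^M the
-- expansion of x + 3·2^M·2 is that of x preceded by 110: it has exactly one more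
-- occurrence of 11, hence r (x + 3·2^M·2) = ¬ r x.  Taking M so large that a
-- window of r fits below 2^M, the window reappears negated 3·2^M·2 places
-- later; for s the same shift works because 2 (n + 3·2^M) + 1 = (2n + 1) + 3·2^M·2.
-- So every factor of r or s occurs negated, and negation is an involution.
module Submission where

open import Defs
open import Data.Bool using (Bool; true; false; not; _xor_; _∧_)
open import Data.Bool.Properties using (∧-zeroʳ; xor-comm; xor-identityʳ; not-distribˡ-xor; not-involutive)
open import Data.List using (List; []; _∷_; length)
open import Data.Nat using (ℕ; zero; suc; _+_; _*_; _^_; _≤_; _<_; z≤n; s≤s)
open import Data.Nat.Properties
open import Data.Nat.DivMod using (_/_; _%_; m/n<m; m*n/n≡m; +-distrib-/-∣ʳ; [m+kn]%n≡m%n; m<n*o⇒m/o<n)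
open import Data.Nat.Divisibility using (divides)
open import Data.Nat.Tactic.RingSolver using (solve-∀)
open import Data.Product using (∃-syntax; _,_)
open import Data.Sum using (_⊎_; inj₁; inj₂)
open import Data.Unit using (tt)
open import Function.Bundles using (_⇔_; mk⇔)
open import Relation.Binary.PropositionalEquality
  using (_≡_; refl; sym; trans; cong; cong₂; subst; subst₂; module ≡-Reasoning)

lsb : ℕ → Bool
lsb n = isOne (n % 2)

half-suc≤ : ∀ m → suc m / 2 ≤ m
half-suc≤ m = <⇒≤pred (m/n<m (suc m) 2 (s≤s (s≤s z≤n)))

bitsF-fuel-irrelevant : ∀ f g n → n ≤ f → n ≤ g → bitsF f n ≡ bitsF g n
bitsF-fuel-irrelevant zero    zero    zero    _       _       = refl
bitsF-fuel-irrelevant zero    (suc g) zero    _       _       = refl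
bitsF-fuel-irrelevant (suc f) zero    zero    _       _       = refl
bitsF-fuel-irrelevant (suc f) (suc g) zero    _       _       = refl
bitsF-fuel-irrelevant (suc f) (suc g) (suc m) (s≤s m≤f) (s≤s m≤g) =
  cong (lsb (suc m) ∷_)
    (bitsF-fuel-irrelevant f g (suc m / 2) (≤-trans (half-suc≤ m) m≤f) (≤-trans (half-suc≤ m) m≤g))

bits-suc : ∀ m → bits (suc m) ≡ lsb (suc m) ∷ bits (suc m / 2)
bits-suc m = cong (lsb (suc m) ∷_) (bitsF-fuel-irrelevant m (suc m / 2) (suc m / 2) (half-suc≤ m) ≤-refl)

firstDigit : List Bool → Bool
firstDigit []      = false
firstDigit (b ∷ _) = b

firstDigit-bits : ∀ n → firstDigit (bits n) ≡ lsb n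
firstDigit-bits zero    = refl
firstDigit-bits (suc m) = cong firstDigit (bits-suc m)

parity-count11-∷ : ∀ b L → parity (count11 (b ∷ L)) ≡ parity (count11 L) xor (b ∧ firstDigit L)
parity-count11-∷ b     []           = sym (∧-zeroʳ b)
parity-count11-∷ true  (true ∷ L)   = sym (xor-comm (parity (count11 (true ∷ L))) true)
parity-count11-∷ true  (false ∷ L)  = sym (xor-identityʳ _)
parity-count11-∷ false (_ ∷ L)      = sym (xor-identityʳ _)

r-half : ∀ n → r n ≡ r (n / 2) xor (lsb n ∧ lsb (n / 2))
r-half zero    = refl
r-half (suc m) = begin
    parity (count11 (bits (suc m)))
  ≡⟨ cong (λ L → parity (count11 L)) (bits-suc m) ⟩
    parity (count11 (lsb (suc m) ∷ bits (suc m / 2)))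
  ≡⟨ parity-count11-∷ (lsb (suc m)) (bits (suc m / 2)) ⟩
    r (suc m / 2) xor (lsb (suc m) ∧ firstDigit (bits (suc m / 2)))
  ≡⟨ cong (λ b → r (suc m / 2) xor (lsb (suc m) ∧ b)) (firstDigit-bits (suc m / 2)) ⟩
    r (suc m / 2) xor (lsb (suc m) ∧ lsb (suc m / 2))
  ∎
  where open ≡-Reasoning

[m+k*2]/2≡m/2+k : ∀ m k → (m + k * 2) / 2 ≡ m / 2 + k
[m+k*2]/2≡m/2+k m k = trans (+-distrib-/-∣ʳ m (divides k refl)) (cong (m / 2 +_) (m*n/n≡m k 2))

lsb-[m+k*2] : ∀ m k → lsb (m + k * 2) ≡ lsb m
lsb-[m+k*2] m k = cong isOne ([m+kn]%n≡m%n m k 2)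

3*2^[1+M]≡3*2^M*2 : ∀ M → 3 * 2 ^ suc M ≡ 3 * 2 ^ M * 2
3*2^[1+M]≡3*2^M*2 M = trans (cong (3 *_) (*-comm 2 (2 ^ M))) (sym (*-assoc 3 (2 ^ M) 2))

r-flip : ∀ M x → x < 2 ^ M → r (x + 3 * 2 ^ M * 2) ≡ not (r x)
r-flip zero    zero    _         = refl
r-flip zero    (suc x) (s≤s ())
r-flip (suc M) x       x<2^[1+M] = begin
    r n
  ≡⟨ r-half n ⟩
    r (n / 2) xor (lsb n ∧ lsb (n / 2))
  ≡⟨ cong (λ m → r m xor (lsb n ∧ lsb m)) n/2≡x/2+shift ⟩
    r (x / 2 + shift) xor (lsb n ∧ lsb (x / 2 + shift))
  ≡⟨ cong (λ b → r (x / 2 + shift) xor (b ∧ lsb (x / 2 + shift))) (lsb-[m+k*2] x (3 * 2 ^ suc M)) ⟩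
    r (x / 2 + shift) xor (lsb x ∧ lsb (x / 2 + shift))
  ≡⟨ cong (λ b → r (x / 2 + shift) xor (lsb x ∧ b)) (lsb-[m+k*2] (x / 2) (3 * 2 ^ M)) ⟩
    r (x / 2 + shift) xor (lsb x ∧ lsb (x / 2))
  ≡⟨ cong (λ b → b xor (lsb x ∧ lsb (x / 2))) (r-flip M (x / 2) x/2<2^M) ⟩
    not (r (x / 2)) xor (lsb x ∧ lsb (x / 2))
  ≡⟨ sym (not-distribˡ-xor (r (x / 2)) (lsb x ∧ lsb (x / 2))) ⟩
    not (r (x / 2) xor (lsb x ∧ lsb (x / 2)))
  ≡⟨ cong not (sym (r-half x)) ⟩
    not (r x)
  ∎
  where
  open ≡-Reasoning
  shift n : ℕ
  shift = 3 * 2 ^ M * 2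
  n = x + 3 * 2 ^ suc M * 2
  n/2≡x/2+shift : n / 2 ≡ x / 2 + shift
  n/2≡x/2+shift = trans ([m+k*2]/2≡m/2+k x (3 * 2 ^ suc M)) (cong (x / 2 +_) (3*2^[1+M]≡3*2^M*2 M))
  x/2<2^M : x / 2 < 2 ^ M
  x/2<2^M = m<n*o⇒m/o<n (subst (x <_) (*-comm 2 (2 ^ M)) x<2^[1+M])

n<2^n : ∀ n → n < 2 ^ n
n<2^n zero    = s≤s z≤n
n<2^n (suc n) = +-mono-≤ (m^n>0 2 n) (≤-trans (n<2^n n) (m≤m+n (2 ^ n) 0))

window<2^[i+L] : ∀ {i k L} → k < L → k + i < 2 ^ (i + L)
window<2^[i+L] {i} {k} {L} k<L =
  <-≤-trans (subst (k + i <_) (+-comm L i) (+-monoˡ-< i k<L)) (<⇒≤ (n<2^n (i + L)))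

1+2n<2^[1+M] : ∀ {n} M → n < 2 ^ M → suc (2 * n) < 2 ^ suc M
1+2n<2^[1+M] {n} M n<2^M = ≤-trans (≤-reflexive (sym (*-suc 2 n))) (*-monoʳ-≤ 2 n<2^M)

NegatedCopy : InfWord → ℕ → ℕ → ℕ → Set
NegatedCopy u L i j = ∀ k → k < L → u (k + j) ≡ not (u (k + i))

NegatedWindows : InfWord → Set
NegatedWindows u = ∀ i L → ∃[ j ] NegatedCopy u L i j

occursAt-negate : ∀ u w {i j} → OccursAt u i w → NegatedCopy u (length w) i j → OccursAt u j (negate w)
occursAt-negate u []      _         _    = tt
occursAt-negate u (b ∷ w) (ui≡b , occ) copy =
  trans (copy 0 (s≤s z≤n)) (cong not ui≡b) ,
  occursAt-negate u w occ (λ k k<L →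
    subst₂ (λ a c → u a ≡ not (u c)) (sym (+-suc k _)) (sym (+-suc k _)) (copy (suc k) (s≤s k<L)))

negate-subword : ∀ {u} → NegatedWindows u → ∀ w → IsSubword w u → IsSubword (negate w) u
negate-subword windows w (i , occ) with windows i (length w)
... | j , copy = j , occursAt-negate _ w occ copy

negate-involutive : ∀ w → negate (negate w) ≡ w
negate-involutive []      = refl
negate-involutive (b ∷ w) = cong₂ _∷_ (not-involutive b) (negate-involutive w)

r-negatedWindows : NegatedWindows r
r-negatedWindows i L = i + 3 * 2 ^ (i + L) * 2 , λ k k<L →
  trans (cong r (sym (+-assoc k i _))) (r-flip (i + L) (k + i) (window<2^[i+L] k<L))

2[k+[i+a]]+1≡2[k+i]+1+a*2 : ∀ k i a → suc (2 * (k + (i + a))) ≡ suc (2 * (k + i)) + a * 2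
2[k+[i+a]]+1≡2[k+i]+1+a*2 = solve-∀

s-negatedWindows : NegatedWindows s
s-negatedWindows i L = i + 3 * 2 ^ M , λ k k<L →
  trans (cong r (2[k+[i+a]]+1≡2[k+i]+1+a*2 k i (3 * 2 ^ M)))
        (r-flip M (suc (2 * (k + i))) (1+2n<2^[1+M] (i + L) (window<2^[i+L] k<L)))
  where M = suc (i + L)

negatedWindows : ∀ {u} → (u ≡ r) ⊎ (u ≡ s) → NegatedWindows u
negatedWindows (inj₁ refl) = r-negatedWindows
negatedWindows (inj₂ refl) = s-negatedWindows

lemma4p2 : (u : InfWord) → (u ≡ r) ⊎ (u ≡ s) →
    (w : List Bool) → IsSubword w u ⇔ IsSubword (negate w) u
lemma4p2 u u∈rs w = mk⇔ (negate-subword windows w) negated⇒original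
  where
  windows : NegatedWindows u
  windows = negatedWindows u∈rs
  negated⇒original : IsSubword (negate w) u → IsSubword w u
  negated⇒original occ =
    subst (λ v → IsSubword v u) (negate-involutive w) (negate-subword windows (negate w) occ)
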